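{- Let $\ell$ be a prime, $p\neq \ell$ a prime and $n\ge 1$. Let $a\in\mathbb{F}_{p^n}$ and let $\alpha\in\mathbb{F}_{p^{2n}}^\times$ be a root of $u(x)=x^2-ax+1$ (so $a=\alpha+\alpha^{ -1}$). Write the multiplicative order of $\alpha$ in $\mathbb{F}_{p^{2n}}^\times$ as $\ell^k d$ with $\gcd(\ell,d)=1$. Then, with respect to the map $T_\ell:\mathbb{F}_{p^n}\to\mathbb{F}_{p^n}$, the preperiod of $a$ is $k$ and the period of $T_\ell^k(a)$ is $c(d)$.
   Context: For $d\ge 0$, $T_d\in\mathbb{Z}[x]$ is the Chebyshev polynomial of the first kind: the monic degree-$d$ polynomial with $T_d(z+z^{ -1})=z^d+z^{ -d}$; it acts on $\mathbb{F}_{p^n}$ via reduction of its coefficients mod $p$. $T_\ell^j$ denotes the $j$-fold iterate ($T_\ell^0(x)=x$). For a map $\phi:S\to S$, an element $a$ has preperiod $\rho$ if $\rho\ge0$ and $\pi\ge1$ are the minimal integers with $\phi^{\rho+\pi}(a)=\phi^\rho(a)$; if $\rho=0$, $a$ is periodic with period $\pi$. For a positive integer $d$, $c(d)$ denotes the order of (the class of) $\ell$ in the group $(\mathbb{Z}/d\mathbb{Z})^\times/\{\pm1\}$. -}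

module Defs where

open import Level using (0ℓ)
open import Data.Nat using (ℕ; zero; suc; _∸_; _^_; _≤_)
import Data.Nat as N
open import Data.Nat.Divisibility using (_∣_)
open import Data.Fin using (Fin)
open import Data.Product using (Σ; _×_)
open import Data.Sum using (_⊎_)
open import Relation.Nullary using (¬_)
open import Relation.Binary.PropositionalEquality using (_≡_)
open import Function.Bundles using (_↔_)
open import Algebra.Structures using (IsCommutativeRing)

record Field : Set₁ where
  infixl 6 _+_ _-_
  infixl 7 _*_
  field
    Carrier : Set
    _+_ _*_ : Carrier → Carrier → Carrier
    -_      : Carrier → Carrier
    0# 1#   : Carrier
    isCommutativeRing : IsCommutativeRing _≡_ _+_ _*_ -_ 0# 1#
    0≢1     : ¬ (0# ≡ 1#)
    inverse : (x : Carrier) → ¬ (x ≡ 0#) → Σ Carrier (λ y → x * y ≡ 1#)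

  _-_ : Carrier → Carrier → Carrier
  x - y = x + (- y)

  2# : Carrier
  2# = 1# + 1#

  _^ᶠ_ : Carrier → ℕ → Carrier
  x ^ᶠ zero  = 1#
  x ^ᶠ suc m = x * (x ^ᶠ m)

  -- Chebyshev polynomial T_d of the first kind, evaluated on the field:
  -- T_0 = 2, T_1 = x, T_{d+2} = x T_{d+1} - T_d  (integer coefficients,
  -- acting through the canonical map ℤ → field, i.e. reduced mod the char.)
  cheb : ℕ → Carrier → Carrier
  cheb zero x = 2#
  cheb (suc zero) x = x
  cheb (suc (suc d)) x = x * cheb (suc d) x - cheb d x

record FiniteField (q : ℕ) : Set₁ where
  field
    field' : Field
  open Field field' public
  field
    card : Carrier ↔ Fin q

record FieldHom (K L : Field) : Set where
  private
    module K = Field K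
    module L = Field L
  field
    map  : K.Carrier → L.Carrier
    map-+ : ∀ x y → map (x K.+ y) ≡ map x L.+ map y
    map-* : ∀ x y → map (x K.* y) ≡ map x L.* map y
    map-1 : map K.1# ≡ L.1#

iter : {A : Set} → (A → A) → ℕ → A → A
iter f zero x = x
iter f (suc j) x = f (iter f j x)

PrePeriodData : {A : Set} → (A → A) → A → ℕ → ℕ → Set
PrePeriodData φ a ρ π =
  1 ≤ π × iter φ (ρ N.+ π) a ≡ iter φ ρ a ×
  (∀ ρ' π' → 1 ≤ π' → iter φ (ρ' N.+ π') a ≡ iter φ ρ' a → ρ ≤ ρ' × π ≤ π')

HasPreperiod : {A : Set} → (A → A) → A → ℕ → Set
HasPreperiod φ a ρ = Σ ℕ (λ π → PrePeriodData φ a ρ π)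

HasPeriod : {A : Set} → (A → A) → A → ℕ → Set
HasPeriod φ a π = PrePeriodData φ a 0 π

IsMultOrder : (F : Field) → Field.Carrier F → ℕ → Set
IsMultOrder F x m =
  1 ≤ m × x ^ᶠ m ≡ 1# × (∀ m' → 1 ≤ m' → x ^ᶠ m' ≡ 1# → m ≤ m')
  where open Field F

-- c = c(d): order of ℓ in (ℤ/dℤ)^× / {±1}, i.e. least c ≥ 1 with ℓ^c ≡ ±1 (mod d)
IsOrderModPM : ℕ → ℕ → ℕ → Set
IsOrderModPM ℓ d c =
  1 ≤ c × ((d ∣ (ℓ ^ c ∸ 1)) ⊎ (d ∣ (ℓ ^ c N.+ 1))) ×
  (∀ c' → 1 ≤ c' → (d ∣ (ℓ ^ c' ∸ 1)) ⊎ (d ∣ (ℓ ^ c' N.+ 1)) → c ≤ c')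

{-# OPTIONS --safe #-}
module Submission where

-- Embed 𝔽_{p^n} in 𝔽_{p^{2n}} and write a = α + α⁻¹.  Since T_m(u + u⁻¹) = uᵐ + u⁻ᵐ,
-- the j-th iterate of a is α^{ℓʲ} + α^{-ℓʲ}, and two such sums α^x + α^{-x}, α^y + α^{-y}
-- agree iff α^x = α^{±y}, i.e. iff ord α = ℓᵏ d divides x ∓ y.  So T_ℓ^{ρ+π}(a) = T_ℓ^ρ(a)
-- iff ℓᵏ d ∣ ℓ^ρ (ℓ^π ∓ 1); as ℓ ∤ ℓ^π ∓ 1 and ℓ ⊥ d, this means k ≤ ρ and ℓ^π ≡ ±1 (mod d).
-- Minimising ρ and π gives preperiod k and period c(d).

open import Defs
open import Level using (0ℓ)
import Data.Nat as ℕ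
open import Data.Nat.Base using (ℕ; zero; suc; _∸_; NonZero; z≤n; s≤s)
import Data.Nat.Properties as ℕ
open import Data.Nat.Divisibility
  using (_∣_; divides; _∣?_; 1∣_; ∣-trans; m∣m*n; n∣m*n; *-pres-∣; *-monoʳ-∣; *-cancelˡ-∣;
         ∣m+n∣m⇒∣n; >⇒∤; m%n≡0⇒n∣m)
open import Data.Nat.DivMod using (_%_; _/_; m≡m%n+[m/n]*n; m%n<n)
open import Data.Nat.Coprimality as Coprime using (Coprime; coprime-divisor)
open import Data.Nat.Induction using (<-rec)
open import Data.Nat.Primality using (Prime; prime⇒nonTrivial)
open import Data.Fin using (Fin; toℕ)
open import Data.Fin.Properties using (pigeonhole; inj⇒≟)
open import Data.Product using (Σ; ∃; ∃₂; _×_; _,_; proj₁; proj₂)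
open import Data.Product.Algebra using (×-distribˡ-⊎)
open import Data.Sum as Sum using (_⊎_; inj₁; inj₂)
open import Data.Sum.Function.Propositional using (_⊎-⇔_)
open import Function using (_∘_; _↔_; _⇔_; mk⇔; Equivalence; Injection)
open import Function.Construct.Composition using (_⇔-∘_)
open import Function.Properties.Inverse using (↔⇒⇔; ↔⇒↣)
import Function.Properties.Equivalence as ⇔
open import Relation.Nullary using (¬_; yes; no; contradiction)
open import Relation.Nullary.Decidable using (_×-dec_; _⊎-dec_)
open import Relation.Unary using (Decidable)
open import Relation.Binary.Definitions using (DecidableEquality)
open import Relation.Binary.PropositionalEquality
import Relation.Binary.Reasoning.Setoid
open import Algebra.Bundles using (CommutativeRing)
open import Algebra.Structures using (IsCommutativeRing)
import Algebra.Properties.Ring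
import Algebra.Properties.Group
import Algebra.Properties.CommutativeSemigroup
import Algebra.Properties.CommutativeSemiring.Exp
import Algebra.Solver.CommutativeMonoid

module FieldProperties (F : Field) where
  open Field F
  open IsCommutativeRing isCommutativeRing public
    using (+-comm; +-identityʳ; -‿inverseʳ; *-assoc; *-comm; *-identityˡ;
           *-identityʳ; distribˡ; distribʳ; zeroˡ; zeroʳ)
  open ≡-Reasoning

  commutativeRing : CommutativeRing 0ℓ 0ℓ
  commutativeRing = record { isCommutativeRing = isCommutativeRing }

  open Algebra.Properties.CommutativeSemiring.Exp
    (CommutativeRing.commutativeSemiring commutativeRing) public
    using (_^_; ^-homo-*; ^-assocʳ; ^-distrib-*)
  open Algebra.Properties.CommutativeSemigroup
    (CommutativeRing.+-commutativeSemigroup commutativeRing) using (xy∙z≈xz∙y)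
  open Algebra.Properties.Group (CommutativeRing.+-group commutativeRing) using (x≈z//y)
  open Algebra.Properties.Group (CommutativeRing.+-group commutativeRing) public
    using () renaming (x∙y⁻¹≈ε⇒x≈y to x-y≡0⇒x≡y; x≈y⇒x∙y⁻¹≈ε to x≡y⇒x-y≡0)
  open Algebra.Properties.Ring (CommutativeRing.ring commutativeRing)
    using (x[y-z]≈xy-xz; [y-z]x≈yx-zx)
  open Algebra.Solver.CommutativeMonoid (CommutativeRing.+-commutativeMonoid commutativeRing)
    using (solve; _⊕_; _⊜_)

  ^ᶠ≡^ : ∀ x n → x ^ᶠ n ≡ x ^ n
  ^ᶠ≡^ x zero    = refl
  ^ᶠ≡^ x (suc n) = cong (x *_) (^ᶠ≡^ x n)

  1^n≡1 : ∀ n → 1# ^ n ≡ 1#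
  1^n≡1 zero    = refl
  1^n≡1 (suc n) = trans (*-identityˡ _) (1^n≡1 n)

  ^-inverse : ∀ {u v} → u * v ≡ 1# → ∀ n → u ^ n * v ^ n ≡ 1#
  ^-inverse {u} {v} uv n = begin
    u ^ n * v ^ n  ≡⟨ ^-distrib-* u v n ⟨
    (u * v) ^ n    ≡⟨ cong (_^ n) uv ⟩
    1# ^ n         ≡⟨ 1^n≡1 n ⟩
    1#             ∎

  inverse-unique : ∀ {u v w} → u * v ≡ 1# → u * w ≡ 1# → v ≡ w
  inverse-unique {u} {v} {w} uv uw = begin
    v            ≡⟨ *-identityʳ v ⟨
    v * 1#       ≡⟨ cong (v *_) uw ⟨
    v * (u * w)  ≡⟨ *-assoc v u w ⟨
    v * u * w    ≡⟨ cong (_* w) (trans (*-comm v u) uv) ⟩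
    1# * w       ≡⟨ *-identityˡ w ⟩
    w            ∎

  inverse-cancelˡ : ∀ {u v} → u * v ≡ 1# → ∀ x → u * (v * x) ≡ x
  inverse-cancelˡ {u} {v} uv x = trans (sym (*-assoc u v x)) (trans (cong (_* x) uv) (*-identityˡ x))

  +≡+⇒-≡- : ∀ {x y z w} → x + y ≡ z + w → x - w ≡ z - y
  +≡+⇒-≡- {x} {y} {z} {w} eq = x≈z//y (x - w) y z (begin
    x - w + y  ≡⟨ xy∙z≈xz∙y x (- w) y ⟩
    x + y - w  ≡⟨ cong (_- w) eq ⟩
    z + w - w  ≡⟨ x≈z//y z w _ refl ⟨
    z          ∎)

  *-cancelʳ-unit : ∀ {w w′ x y} → w * w′ ≡ 1# → x * w ≡ y * w → x ≡ y
  *-cancelʳ-unit {w} {w′} {x} {y} ww′ xw≡yw = begin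
    x              ≡⟨ *-identityʳ x ⟨
    x * 1#         ≡⟨ cong (x *_) ww′ ⟨
    x * (w * w′)   ≡⟨ *-assoc x w w′ ⟨
    x * w * w′     ≡⟨ cong (_* w′) xw≡yw ⟩
    y * w * w′     ≡⟨ *-assoc y w w′ ⟩
    y * (w * w′)   ≡⟨ cong (y *_) ww′ ⟩
    y * 1#         ≡⟨ *-identityʳ y ⟩
    y              ∎

  root⇒≡sum-of-roots : ∀ {x y m} → x * y ≡ 1# → x * x - m * x + 1# ≡ 0# → m ≡ x + y
  root⇒≡sum-of-roots {x} {y} {m} xy root = sym (begin
    x + y                 ≡⟨ cong₂ _+_ (*-identityʳ x) (*-identityˡ y) ⟨
    x * 1# + 1# * y       ≡⟨ cong (λ t → x * t + 1# * y) xy ⟨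
    x * (x * y) + 1# * y  ≡⟨ cong (_+ 1# * y) (*-assoc x x y) ⟨
    x * x * y + 1# * y    ≡⟨ distribʳ y (x * x) 1# ⟨
    (x * x + 1#) * y      ≡⟨ cong (_* y) x²+1≡mx ⟩
    m * x * y             ≡⟨ *-assoc m x y ⟩
    m * (x * y)           ≡⟨ cong (m *_) xy ⟩
    m * 1#                ≡⟨ *-identityʳ m ⟩
    m                     ∎)
    where
    x²+1≡mx : x * x + 1# ≡ m * x
    x²+1≡mx = x-y≡0⇒x≡y _ _ (trans (xy∙z≈xz∙y (x * x) 1# (- (m * x))) root)

  cheb-+-inverse : ∀ {u v} → u * v ≡ 1# → ∀ m → cheb m (u + v) ≡ u ^ m + v ^ m
  cheb-+-inverse uv zero = refl
  cheb-+-inverse {u} {v} uv (suc zero) = sym (cong₂ _+_ (*-identityʳ u) (*-identityʳ v))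
  cheb-+-inverse {u} {v} uv (suc (suc m)) = begin
    (u + v) * cheb (suc m) (u + v) - cheb m (u + v)
      ≡⟨ cong₂ (λ s t → (u + v) * s - t) (cheb-+-inverse uv (suc m)) (cheb-+-inverse uv m) ⟩
    (u + v) * (u * U + v * V) - (U + V)
      ≡⟨ x≈z//y _ (U + V) _ recurrence ⟨
    u * (u * U) + v * (v * V) ∎
    where
    U V : Carrier
    U = u ^ m
    V = v ^ m
    recurrence : u * (u * U) + v * (v * V) + (U + V) ≡ (u + v) * (u * U + v * V)
    recurrence = sym (begin
      (u + v) * (u * U + v * V)
        ≡⟨ distribʳ _ u v ⟩
      u * (u * U + v * V) + v * (u * U + v * V)
        ≡⟨ cong₂ _+_ (distribˡ u _ _) (distribˡ v _ _) ⟩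
      (u * (u * U) + u * (v * V)) + (v * (u * U) + v * (v * V))
        ≡⟨ cong₂ (λ s t → (u * (u * U) + s) + (t + v * (v * V)))
                 (inverse-cancelˡ uv V) (inverse-cancelˡ (trans (*-comm v u) uv) U) ⟩
      (u * (u * U) + V) + (U + v * (v * V))
        ≡⟨ solve 4 (λ a b U V → (a ⊕ V) ⊕ (U ⊕ b) ⊜ (a ⊕ b) ⊕ (U ⊕ V)) refl
                 (u * (u * U)) (v * (v * V)) U V ⟩
      u * (u * U) + v * (v * V) + (U + V) ∎)

  module _ (_≟_ : DecidableEquality Carrier) where

    zero-product : ∀ {x y} → x * y ≡ 0# → x ≡ 0# ⊎ y ≡ 0#
    zero-product {x} {y} xy≡0 with x ≟ 0#
    ... | yes x≡0 = inj₁ x≡0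
    ... | no  x≢0 = inj₂ (begin
      y             ≡⟨ *-identityˡ y ⟨
      1# * y        ≡⟨ cong (_* y) (trans (*-comm x⁻¹ x) xx⁻¹) ⟨
      x⁻¹ * x * y   ≡⟨ *-assoc x⁻¹ x y ⟩
      x⁻¹ * (x * y) ≡⟨ cong (x⁻¹ *_) xy≡0 ⟩
      x⁻¹ * 0#      ≡⟨ zeroʳ x⁻¹ ⟩
      0#            ∎)
      where
      x⁻¹ : Carrier
      x⁻¹ = proj₁ (inverse x x≢0)
      xx⁻¹ : x * x⁻¹ ≡ 1#
      xx⁻¹ = proj₂ (inverse x x≢0)

    +-inverse-≡⇔ : ∀ {u u′ v v′} → u * u′ ≡ 1# → v * v′ ≡ 1# →
                   u + u′ ≡ v + v′ ⇔ (u ≡ v ⊎ u ≡ v′)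
    +-inverse-≡⇔ {u} {u′} {v} {v′} uu′ vv′ = mk⇔ to from
      where
      to : u + u′ ≡ v + v′ → u ≡ v ⊎ u ≡ v′
      to sum≡ = Sum.map (x-y≡0⇒x≡y u v) (x-y≡0⇒x≡y u v′) (zero-product (begin
        (u - v) * (u - v′)               ≡⟨ [y-z]x≈yx-zx (u - v′) u v ⟩
        u * (u - v′) - v * (u - v′)      ≡⟨ x≡y⇒x-y≡0 (begin
          u * (u - v′)                     ≡⟨ cong (u *_) (+≡+⇒-≡- sum≡) ⟩
          u * (v - u′)                     ≡⟨ x[y-z]≈xy-xz u v u′ ⟩
          u * v - u * u′                   ≡⟨ cong₂ _-_ (*-comm u v) (trans uu′ (sym vv′)) ⟩
          v * u - v * v′                   ≡⟨ x[y-z]≈xy-xz v u v′ ⟨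
          v * (u - v′)                     ∎) ⟩
        0#                               ∎))
      from : u ≡ v ⊎ u ≡ v′ → u + u′ ≡ v + v′
      from (inj₁ refl) = cong (u +_) (inverse-unique uu′ vv′)
      from (inj₂ refl) = trans (cong (u +_) (inverse-unique uu′ (trans (*-comm u v) vv′)))
                               (+-comm u v)

module FieldHomProperties {K L : Field} (ι : FieldHom K L) where
  private
    module K = Field K
    module KP = FieldProperties K
    module LP = FieldProperties L
  open Field L using (_+_; _*_; -_; _-_; 0#; 1#; cheb; 0≢1)
  open FieldHom ι
  open Algebra.Properties.Ring (CommutativeRing.ring LP.commutativeRing) using (x+x≈x⇒x≈0)
  open Algebra.Properties.Group (CommutativeRing.+-group LP.commutativeRing)
    using (inverseʳ-unique)

  map-0 : map K.0# ≡ 0#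
  map-0 = x+x≈x⇒x≈0 _ (trans (sym (map-+ _ _)) (cong map (KP.+-identityʳ _)))

  map-neg : ∀ x → map (K.- x) ≡ - map x
  map-neg x = inverseʳ-unique (map x) _
    (trans (sym (map-+ _ _)) (trans (cong map (KP.-‿inverseʳ x)) map-0))

  map-sub : ∀ x y → map (x K.- y) ≡ map x - map y
  map-sub x y = trans (map-+ _ _) (cong (map x +_) (map-neg y))

  map-cheb : ∀ m x → map (K.cheb m x) ≡ cheb m (map x)
  map-cheb zero          x = trans (map-+ _ _) (cong₂ _+_ map-1 map-1)
  map-cheb (suc zero)    x = refl
  map-cheb (suc (suc m)) x = trans (map-sub _ _)
    (cong₂ _-_ (trans (map-* _ _) (cong (map x *_) (map-cheb (suc m) x))) (map-cheb m x))

  map-injective : DecidableEquality K.Carrier → ∀ {x y} → map x ≡ map y → x ≡ y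
  map-injective _≟_ {x} {y} mx≡my with x ≟ y
  ... | yes x≡y = x≡y
  ... | no  x≢y = contradiction (begin
      0#                      ≡⟨ LP.zeroˡ (map z) ⟨
      0# * map z              ≡⟨ cong (_* map z) (trans (map-sub x y) (LP.x≡y⇒x-y≡0 mx≡my)) ⟨
      map (x K.- y) * map z   ≡⟨ map-* _ _ ⟨
      map ((x K.- y) K.* z)   ≡⟨ cong map [x-y]z≡1 ⟩
      map K.1#                ≡⟨ map-1 ⟩
      1#                      ∎) 0≢1
    where
    open ≡-Reasoning
    x-y≢0 : ¬ x K.- y ≡ K.0#
    x-y≢0 x-y≡0 = x≢y (KP.x-y≡0⇒x≡y x y x-y≡0)
    z : K.Carrier
    z = proj₁ (K.inverse (x K.- y) x-y≢0)
    [x-y]z≡1 : (x K.- y) K.* z ≡ K.1#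
    [x-y]z≡1 = proj₂ (K.inverse (x K.- y) x-y≢0)

module MultiplicativeOrder {F : Field} {α : Field.Carrier F} {N : ℕ} (ord : IsMultOrder F α N) where
  open Field F
  open FieldProperties F
  open ≡-Reasoning

  private
    1≤N : 1 ℕ.≤ N
    1≤N = proj₁ ord

    instance
      N≢0 : NonZero N
      N≢0 = ℕ.>-nonZero 1≤N

    α^N≡1 : α ^ N ≡ 1#
    α^N≡1 = trans (sym (^ᶠ≡^ α N)) (proj₁ (proj₂ ord))

    below-order : ∀ {r} → r ℕ.< N → α ^ r ≡ 1# → r ≡ 0
    below-order {zero}  _   _    = refl
    below-order {suc r} r<N αʳ≡1 =
      contradiction (proj₂ (proj₂ ord) (suc r) (s≤s z≤n) (trans (^ᶠ≡^ α (suc r)) αʳ≡1))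
                    (ℕ.<⇒≱ r<N)

  α⁻¹ : Carrier
  α⁻¹ = α ^ ℕ.pred N

  α*α⁻¹≡1 : α * α⁻¹ ≡ 1#
  α*α⁻¹≡1 = trans (cong (α ^_) (ℕ.suc-pred N)) α^N≡1

  ∣⇒^≡1 : ∀ {n} → N ∣ n → α ^ n ≡ 1#
  ∣⇒^≡1 (divides q refl) = begin
    α ^ (q ℕ.* N)  ≡⟨ cong (α ^_) (ℕ.*-comm q N) ⟩
    α ^ (N ℕ.* q)  ≡⟨ ^-assocʳ α N q ⟨
    (α ^ N) ^ q    ≡⟨ cong (_^ q) α^N≡1 ⟩
    1# ^ q         ≡⟨ 1^n≡1 q ⟩
    1#             ∎

  ^≡1⇔∣ : ∀ {n} → α ^ n ≡ 1# ⇔ N ∣ n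
  ^≡1⇔∣ {n} = mk⇔ to ∣⇒^≡1
    where
    to : α ^ n ≡ 1# → N ∣ n
    to αⁿ≡1 = m%n≡0⇒n∣m n N (below-order (m%n<n n N) (begin
      α ^ (n % N)                           ≡⟨ *-identityʳ _ ⟨
      α ^ (n % N) * 1#                      ≡⟨ cong (α ^ (n % N) *_) (∣⇒^≡1 (divides (n / N) refl)) ⟨
      α ^ (n % N) * α ^ ((n / N) ℕ.* N)     ≡⟨ ^-homo-* α (n % N) _ ⟨
      α ^ (n % N ℕ.+ (n / N) ℕ.* N)         ≡⟨ cong (α ^_) (m≡m%n+[m/n]*n n N) ⟨
      α ^ n                                 ≡⟨ αⁿ≡1 ⟩
      1#                                    ∎))

  ^≡^⇔∣∸ : ∀ {x y} → y ℕ.≤ x → α ^ x ≡ α ^ y ⇔ N ∣ x ∸ y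
  ^≡^⇔∣∸ {x} {y} y≤x = ^≡1⇔∣ ⇔-∘ mk⇔ to from
    where
    split : α ^ x ≡ α ^ (x ∸ y) * α ^ y
    split = trans (cong (α ^_) (sym (ℕ.m∸n+n≡m y≤x))) (^-homo-* α (x ∸ y) y)
    to : α ^ x ≡ α ^ y → α ^ (x ∸ y) ≡ 1#
    to αˣ≡αʸ = *-cancelʳ-unit (^-inverse α*α⁻¹≡1 y)
      (trans (sym split) (trans αˣ≡αʸ (sym (*-identityˡ _))))
    from : α ^ (x ∸ y) ≡ 1# → α ^ x ≡ α ^ y
    from αˣ⁻ʸ≡1 = trans split (trans (cong (_* α ^ y) αˣ⁻ʸ≡1) (*-identityˡ _))

  ^≡⁻¹^⇔∣+ : ∀ {x y} → α ^ x ≡ α⁻¹ ^ y ⇔ N ∣ x ℕ.+ y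
  ^≡⁻¹^⇔∣+ {x} {y} = ^≡1⇔∣ ⇔-∘ mk⇔ to from
    where
    α⁻ʸαʸ≡1 : α⁻¹ ^ y * α ^ y ≡ 1#
    α⁻ʸαʸ≡1 = trans (*-comm _ _) (^-inverse α*α⁻¹≡1 y)
    to : α ^ x ≡ α⁻¹ ^ y → α ^ (x ℕ.+ y) ≡ 1#
    to αˣ≡α⁻ʸ = trans (^-homo-* α x y) (trans (cong (_* α ^ y) αˣ≡α⁻ʸ) α⁻ʸαʸ≡1)
    from : α ^ (x ℕ.+ y) ≡ 1# → α ^ x ≡ α⁻¹ ^ y
    from αˣ⁺ʸ≡1 = *-cancelʳ-unit (^-inverse α*α⁻¹≡1 y)
      (trans (sym (^-homo-* α x y)) (trans αˣ⁺ʸ≡1 (sym α⁻ʸαʸ≡1)))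

  α^± : ℕ → Carrier
  α^± e = α ^ e + α⁻¹ ^ e

  cheb-α^± : ∀ m e → cheb m (α^± e) ≡ α^± (e ℕ.* m)
  cheb-α^± m e = begin
    cheb m (α ^ e + α⁻¹ ^ e)              ≡⟨ cheb-+-inverse (^-inverse α*α⁻¹≡1 e) m ⟩
    (α ^ e) ^ m + (α⁻¹ ^ e) ^ m           ≡⟨ cong₂ _+_ (^-assocʳ α e m) (^-assocʳ α⁻¹ e m) ⟩
    α ^ (e ℕ.* m) + α⁻¹ ^ (e ℕ.* m)       ∎

  α^±≡α^±⇔ : DecidableEquality Carrier → ∀ {x y} → y ℕ.≤ x →
             α^± x ≡ α^± y ⇔ (N ∣ x ∸ y ⊎ N ∣ x ℕ.+ y)
  α^±≡α^±⇔ _≟_ {x} {y} y≤x =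
    (^≡^⇔∣∸ y≤x ⊎-⇔ ^≡⁻¹^⇔∣+ {x} {y})
      ⇔-∘ +-inverse-≡⇔ _≟_ (^-inverse α*α⁻¹≡1 x) (^-inverse α*α⁻¹≡1 y)

open import Data.Nat.Base using (_+_; _*_; _^_; _≤_; _<_; NonTrivial)

^-monoʳ-∣ : ∀ m {n o} → n ≤ o → m ^ n ∣ m ^ o
^-monoʳ-∣ m {o = o} z≤n       = 1∣ (m ^ o)
^-monoʳ-∣ m         (s≤s n≤o) = *-monoʳ-∣ m (^-monoʳ-∣ m n≤o)

^∣^*⇒≤ : ∀ {m} .{{_ : NonZero m}} {n o k} → ¬ m ∣ k → m ^ n ∣ m ^ o * k → n ≤ o
^∣^*⇒≤         {n = zero}                 _   _   = z≤n
^∣^*⇒≤ {m}     {n = suc n} {zero}  {k}   m∤k mⁿ∣ =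
  contradiction (∣-trans (m∣m*n (m ^ n)) (subst (m ^ suc n ∣_) (ℕ.*-identityˡ k) mⁿ∣)) m∤k
^∣^*⇒≤ {m}     {n = suc n} {suc o} {k}   m∤k mⁿ∣ =
  s≤s (^∣^*⇒≤ m∤k (*-cancelˡ-∣ m (subst (m ^ suc n ∣_) (ℕ.*-assoc m (m ^ o) k) mⁿ∣)))

coprime-^-divisor : ∀ {d m n k} → Coprime d m → d ∣ m ^ n * k → d ∣ k
coprime-^-divisor {d} {m} {zero}  {k} _   d∣ = subst (d ∣_) (ℕ.*-identityˡ k) d∣
coprime-^-divisor {d} {m} {suc n} {k} d⊥m d∣ =
  coprime-^-divisor {n = n} d⊥m (coprime-divisor d⊥m (subst (d ∣_) (ℕ.*-assoc m (m ^ n) k) d∣))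

^*∣^*⇔ : ∀ {m d n o k} .{{_ : NonZero m}} → Coprime m d → ¬ m ∣ k →
         m ^ n * d ∣ m ^ o * k ⇔ (n ≤ o × d ∣ k)
^*∣^*⇔ {m} {d} {n} {o} m⊥d m∤k = mk⇔
  (λ ∣mᵒk → ^∣^*⇒≤ m∤k (∣-trans (m∣m*n d) ∣mᵒk) ,
            coprime-^-divisor {n = o} (Coprime.sym m⊥d) (∣-trans (n∣m*n (m ^ n)) ∣mᵒk))
  (λ (n≤o , d∣k) → *-pres-∣ (^-monoʳ-∣ m n≤o) d∣k)

^+∸^≡^*[^∸1] : ∀ m n o → m ^ (n + o) ∸ m ^ n ≡ m ^ n * (m ^ o ∸ 1)
^+∸^≡^*[^∸1] m n o = trans
  (cong₂ _∸_ (ℕ.^-distribˡ-+-* m n o) (sym (ℕ.*-identityʳ (m ^ n))))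
  (sym (ℕ.*-distribˡ-∸ (m ^ n) (m ^ o) 1))

^++^≡^*[^+1] : ∀ m n o → m ^ (n + o) + m ^ n ≡ m ^ n * (m ^ o + 1)
^++^≡^*[^+1] m n o = trans
  (cong₂ _+_ (ℕ.^-distribˡ-+-* m n o) (sym (ℕ.*-identityʳ (m ^ n))))
  (sym (ℕ.*-distribˡ-+ (m ^ n) (m ^ o) 1))

infix 4 _∣_^_∓1

_∣_^_∓1 : ℕ → ℕ → ℕ → Set
d ∣ m ^ n ∓1 = d ∣ m ^ n ∸ 1 ⊎ d ∣ m ^ n + 1

module _ {m : ℕ} .{{_ : NonTrivial m}} where
  private instance
    m≢0 : NonZero m
    m≢0 = ℕ.nonTrivial⇒nonZero m

  m∤1 : ¬ m ∣ 1
  m∤1 = >⇒∤ (ℕ.nonTrivial⇒n>1 m)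

  m∤m^n∸1 : ∀ {n} → 1 ≤ n → ¬ m ∣ m ^ n ∸ 1
  m∤m^n∸1 {suc n} _ m∣ = m∤1 (∣m+n∣m⇒∣n
    (subst (m ∣_) (sym (ℕ.m∸n+n≡m (ℕ.m^n>0 m (suc n)))) (m∣m*n (m ^ n))) m∣)

  m∤m^n+1 : ∀ {n} → 1 ≤ n → ¬ m ∣ m ^ n + 1
  m∤m^n+1 {suc n} _ m∣ = m∤1 (∣m+n∣m⇒∣n m∣ (m∣m*n (m ^ n)))

  ^*∣^+∓^⇔ : ∀ {d k ρ π} → Coprime m d → 1 ≤ π →
             (m ^ k * d ∣ m ^ (ρ + π) ∸ m ^ ρ ⊎ m ^ k * d ∣ m ^ (ρ + π) + m ^ ρ)
               ⇔ (k ≤ ρ × d ∣ m ^ π ∓1)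
  ^*∣^+∓^⇔ {d} {k} {ρ} {π} m⊥d 1≤π rewrite ^+∸^≡^*[^∸1] m ρ π | ^++^≡^*[^+1] m ρ π =
    ⇔.sym (↔⇒⇔ (×-distribˡ-⊎ 0ℓ _ _ _))
      ⇔-∘ (^*∣^*⇔ m⊥d (m∤m^n∸1 1≤π) ⊎-⇔ ^*∣^*⇔ m⊥d (m∤m^n+1 1≤π))

IsLeast : (ℕ → Set) → ℕ → Set
IsLeast Q c = Q c × (∀ {c′} → Q c′ → c ≤ c′)

IsLeastPositive : (ℕ → Set) → ℕ → Set
IsLeastPositive P c = 1 ≤ c × P c × (∀ c′ → 1 ≤ c′ → P c′ → c ≤ c′)

least : ∀ {Q : ℕ → Set} → Decidable Q → ∀ {m} → Q m → ∃ (IsLeast Q)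
least {Q} Q? {m} = <-rec _ search m
  where
  search : ∀ m → (∀ {m′} → m′ < m → Q m′ → ∃ (IsLeast Q)) → Q m → ∃ (IsLeast Q)
  search m smaller qm with ℕ.anyUpTo? Q? m
  ... | yes (m′ , m′<m , qm′) = smaller m′<m qm′
  ... | no  nothing-below     = m , qm , λ {c′} qc′ → ℕ.≮⇒≥ (λ c′<m → nothing-below (c′ , c′<m , qc′))

least-positive : ∀ {P : ℕ → Set} → Decidable P → ∀ {m} → 1 ≤ m → P m → ∃ (IsLeastPositive P)
least-positive P? 1≤m pm with least (λ c → 1 ℕ.≤? c ×-dec P? c) (1≤m , pm)
... | c , (1≤c , pc) , minimal = c , 1≤c , pc , λ c′ 1≤c′ pc′ → minimal (1≤c′ , pc′)

iter-+ : ∀ {A : Set} (φ : A → A) m n x → iter φ m (iter φ n x) ≡ iter φ (m + n) x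
iter-+ φ zero    n x = refl
iter-+ φ (suc m) n x = cong φ (iter-+ φ m n x)

orbit-returns : ∀ {A : Set} {q} → A ↔ Fin q → (φ : A → A) (a : A) →
                ∃₂ λ ρ π → 1 ≤ π × iter φ (ρ + π) a ≡ iter φ ρ a
orbit-returns {A} {q} A↔Fin φ a =
  let i , j , i<j , same = pigeonhole (ℕ.n<1+n q) (to ∘ orbit)
  in toℕ i , toℕ j ∸ toℕ i , ℕ.m<n⇒0<n∸m i<j ,
     trans (cong (λ t → iter φ t a) (ℕ.m+[n∸m]≡n (ℕ.<⇒≤ i<j))) (sym (injective same))
  where
  open Injection (↔⇒↣ A↔Fin) using (to; injective)
  orbit : Fin (suc q) → A
  orbit i = iter φ (toℕ i) a

finite⇒≟ : ∀ {A : Set} {q} → A ↔ Fin q → DecidableEquality A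
finite⇒≟ A↔Fin = inj⇒≟ (↔⇒↣ A↔Fin)

module Orbit {A : Set} (φ : A → A) (a : A) {k : ℕ} {P : ℕ → Set}
  (returns⇔ : ∀ ρ π → 1 ≤ π → iter φ (ρ + π) a ≡ iter φ ρ a ⇔ (k ≤ ρ × P π)) where
  open Equivalence using (to; from)
  open Algebra.Properties.CommutativeSemigroup ℕ.+-commutativeSemigroup using (xy∙z≈xz∙y)

  hasPreperiod : ∀ {c} → IsLeastPositive P c → HasPreperiod φ a k
  hasPreperiod {c} (1≤c , pc , minimal) =
    c , 1≤c , from (returns⇔ k c 1≤c) (ℕ.≤-refl , pc) ,
    λ ρ π 1≤π ret → let k≤ρ , pπ = to (returns⇔ ρ π 1≤π) ret in k≤ρ , minimal π 1≤π pπ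

  hasPeriod : ∀ {c} → IsLeastPositive P c → HasPeriod φ (iter φ k a) c
  hasPeriod {c} (1≤c , pc , minimal) = 1≤c , period , minimality
    where
    open ≡-Reasoning
    period : iter φ c (iter φ k a) ≡ iter φ k a
    period = begin
      iter φ c (iter φ k a)  ≡⟨ iter-+ φ c k a ⟩
      iter φ (c + k) a       ≡⟨ cong (λ t → iter φ t a) (ℕ.+-comm c k) ⟩
      iter φ (k + c) a       ≡⟨ from (returns⇔ k c 1≤c) (ℕ.≤-refl , pc) ⟩
      iter φ k a             ∎
    minimality : ∀ ρ π → 1 ≤ π → iter φ (ρ + π) (iter φ k a) ≡ iter φ ρ (iter φ k a) →
                 0 ≤ ρ × c ≤ π
    minimality ρ π 1≤π ret = z≤n , minimal π 1≤π (proj₂ (to (returns⇔ (ρ + k) π 1≤π) (begin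
      iter φ (ρ + k + π) a         ≡⟨ cong (λ t → iter φ t a) (xy∙z≈xz∙y ρ k π) ⟩
      iter φ (ρ + π + k) a         ≡⟨ iter-+ φ (ρ + π) k a ⟨
      iter φ (ρ + π) (iter φ k a)  ≡⟨ ret ⟩
      iter φ ρ (iter φ k a)        ≡⟨ iter-+ φ ρ k a ⟩
      iter φ (ρ + k) a             ∎)))

module ChebyshevOrbit {K L : Field} (ι : FieldHom K L)
  (_≟ᴷ_ : DecidableEquality (Field.Carrier K)) (_≟ᴸ_ : DecidableEquality (Field.Carrier L))
  {ℓ k d : ℕ} .{{_ : NonTrivial ℓ}} (ℓ⊥d : Coprime ℓ d)
  {α : Field.Carrier L} (ord : IsMultOrder L α (ℓ ^ k * d)) {a : Field.Carrier K}
  where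
  private
    module K = Field K
    module L = Field L
    module LP = FieldProperties L
    module ι = FieldHom ι
    instance
      ℓ≢0 : NonZero ℓ
      ℓ≢0 = ℕ.nonTrivial⇒nonZero ℓ
  open MultiplicativeOrder ord
  open FieldHomProperties ι

  module _ (root : α L.* α L.- ι.map a L.* α L.+ L.1# ≡ L.0#) where

    map-iterate : ∀ j → ι.map (iter (K.cheb ℓ) j a) ≡ α^± (ℓ ^ j)
    map-iterate zero = trans (LP.root⇒≡sum-of-roots α*α⁻¹≡1 root)
                             (sym (cong₂ L._+_ (LP.*-identityʳ α) (LP.*-identityʳ α⁻¹)))
    map-iterate (suc j) = begin
      ι.map (K.cheb ℓ (iter (K.cheb ℓ) j a))  ≡⟨ map-cheb ℓ _ ⟩
      L.cheb ℓ (ι.map (iter (K.cheb ℓ) j a))  ≡⟨ cong (L.cheb ℓ) (map-iterate j) ⟩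
      L.cheb ℓ (α^± (ℓ ^ j))                  ≡⟨ cheb-α^± ℓ (ℓ ^ j) ⟩
      α^± (ℓ ^ j * ℓ)                         ≡⟨ cong α^± (ℕ.*-comm (ℓ ^ j) ℓ) ⟩
      α^± (ℓ ^ suc j)                         ∎
      where open ≡-Reasoning

    returns⇔ : ∀ ρ π → 1 ≤ π →
               iter (K.cheb ℓ) (ρ + π) a ≡ iter (K.cheb ℓ) ρ a ⇔ (k ≤ ρ × d ∣ ℓ ^ π ∓1)
    returns⇔ ρ π 1≤π = begin
      iter (K.cheb ℓ) (ρ + π) a ≡ iter (K.cheb ℓ) ρ a
        ≈⟨ mk⇔ (cong ι.map) (map-injective _≟ᴷ_) ⟩
      ι.map (iter (K.cheb ℓ) (ρ + π) a) ≡ ι.map (iter (K.cheb ℓ) ρ a)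
        ≡⟨ cong₂ _≡_ (map-iterate (ρ + π)) (map-iterate ρ) ⟩
      α^± (ℓ ^ (ρ + π)) ≡ α^± (ℓ ^ ρ)
        ≈⟨ α^±≡α^±⇔ _≟ᴸ_ (ℕ.^-monoʳ-≤ ℓ (ℕ.m≤m+n ρ π)) ⟩
      (ℓ ^ k * d ∣ ℓ ^ (ρ + π) ∸ ℓ ^ ρ ⊎ ℓ ^ k * d ∣ ℓ ^ (ρ + π) + ℓ ^ ρ)
        ≈⟨ ^*∣^+∓^⇔ ℓ⊥d 1≤π ⟩
      (k ≤ ρ × d ∣ ℓ ^ π ∓1)
        ∎
      where open Relation.Binary.Reasoning.Setoid (⇔.⇔-setoid 0ℓ)

proposition2p1 : (ℓ p n : ℕ) → Prime ℓ → Prime p → p ≢ ℓ → 1 ≤ n →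
    (K : FiniteField (p ^ n)) → (L : FiniteField (p ^ (2 * n))) →
    (ι : FieldHom (FiniteField.field' K) (FiniteField.field' L)) →
    (a : FiniteField.Carrier K) → (α : FiniteField.Carrier L) →
    let module K = FiniteField K
        module L = FiniteField L
        module ι = FieldHom ι
    in α L.* α L.- ι.map a L.* α L.+ L.1# ≡ L.0# →
    (k d : ℕ) → IsMultOrder L.field' α (ℓ ^ k * d) → Coprime ℓ d →
    HasPreperiod (K.cheb ℓ) a k ×
    Σ ℕ (λ c → IsOrderModPM ℓ d c × HasPeriod (K.cheb ℓ) (iter (K.cheb ℓ) k a) c)
proposition2p1 ℓ _ _ ℓ-prime _ _ _ K L ι a α root k d ord ℓ⊥d =
  let c , c-least = c-exists in hasPreperiod c-least , c , c-least , hasPeriod c-least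
  where
  instance
    ℓ-nonTrivial : NonTrivial ℓ
    ℓ-nonTrivial = prime⇒nonTrivial ℓ-prime
  open FiniteField K using (card; cheb)
  open ChebyshevOrbit ι (finite⇒≟ card) (finite⇒≟ (FiniteField.card L)) {k = k} ℓ⊥d ord
  open Orbit (cheb ℓ) a (returns⇔ root)
  c-exists : ∃ (IsLeastPositive (λ c → d ∣ ℓ ^ c ∓1))
  c-exists =
    let ρ , π , 1≤π , return = orbit-returns card (cheb ℓ) a
    in least-positive (λ c → d ∣? ℓ ^ c ∸ 1 ⊎-dec d ∣? ℓ ^ c + 1) 1≤π
                      (proj₂ (Equivalence.to (returns⇔ root ρ π 1≤π) return))
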